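{- Let $n\ge 2$, let $\Delta({\mathbb R})={\mathbb R}(1,\dots,1)\subset{\mathbb R}^n$, and let $G_{\mathbb R}=({\mathbb R}^n/\Delta({\mathbb R}))\rtimes\operatorname{Per}(n)$, with $\Lambda_{\mathbb R}=\{(v,1)\}\subset G_{\mathbb R}$ and $K=\{(0,p)\}\cong\operatorname{Per}(n)$. Let $G^+_{\mathbb R}=\{(v,p)\in G_{\mathbb R}: p(v)=v\}$. Then $G^+_{\mathbb R}$ is a set of representatives for $G_{\mathbb R}$ modulo conjugation by elements of $\Lambda_{\mathbb R}$ (i.e. every element of $G_{\mathbb R}$ is $\Lambda_{\mathbb R}$-conjugate to exactly one element of $G^+_{\mathbb R}$), and $G^+_{\mathbb R}$ is stable under conjugation by elements of $K$.
   Context: $\operatorname{Per}(n)$ is the symmetric group on $n$ letters, acting on ${\mathbb R}^n$ (and hence on ${\mathbb R}^n/\Delta({\mathbb R})$) by permuting coordinates. The group law of the semidirect product is $(v,p)(w,q)=(v+p(w),pq)$; in particular $(x,1)(v,p)(x,1)^{ -1}=(v+x-p(x),p)$. -}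

module Defs where

open import Level using (Level; suc; _⊔_)
open import Data.Nat using (ℕ)
open import Data.Fin using (Fin)
open import Data.Fin.Permutation using (Permutation′; _⟨$⟩ʳ_; _⟨$⟩ˡ_; id; flip; _∘ₚ_)
open import Data.Product using (Σ; _×_; _,_; ∃)
open import Data.Sum using (_⊎_)
open import Relation.Nullary using (¬_)
open import Relation.Binary.PropositionalEquality using (_≡_)
open import Algebra.Structures using (IsCommutativeRing)

-- The real numbers, axiomatised as a Dedekind-complete ordered field
-- (unique up to isomorphism), with propositional equality as equality.
record RealField (c : Level) : Set (suc c) where
  infixl 6 _+_
  infixl 7 _*_
  infix 4 _≤_
  field
    ℝ   : Set c
    _+_ : ℝ → ℝ → ℝ
    _*_ : ℝ → ℝ → ℝ
    -_  : ℝ → ℝ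
    0ℝ  : ℝ
    1ℝ  : ℝ
    _≤_ : ℝ → ℝ → Set c
    isCommutativeRing : IsCommutativeRing _≡_ _+_ _*_ -_ 0ℝ 1ℝ
    0≢1       : ¬ (0ℝ ≡ 1ℝ)
    inverse   : ∀ x → ¬ (x ≡ 0ℝ) → Σ ℝ λ y → x * y ≡ 1ℝ
    ≤-refl    : ∀ x → x ≤ x
    ≤-trans   : ∀ {x y z} → x ≤ y → y ≤ z → x ≤ z
    ≤-antisym : ∀ {x y} → x ≤ y → y ≤ x → x ≡ y
    ≤-total   : ∀ x y → (x ≤ y) ⊎ (y ≤ x)
    +-mono-≤  : ∀ {x y} z → x ≤ y → x + z ≤ y + z
    *-nonneg  : ∀ {x y} → 0ℝ ≤ x → 0ℝ ≤ y → 0ℝ ≤ x * y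
    sup : (S : ℝ → Set c) → Σ ℝ S → Σ ℝ (λ b → ∀ s → S s → s ≤ b) →
          Σ ℝ λ u → (∀ s → S s → s ≤ u) × (∀ b → (∀ s → S s → s ≤ b) → u ≤ b)

module Semidirect {c : Level} (R : RealField c) (n : ℕ) where
  open RealField R

  Vec : Set c
  Vec = Fin n → ℝ

  _+ᵥ_ : Vec → Vec → Vec
  (v +ᵥ w) i = v i + w i

  -ᵥ_ : Vec → Vec
  (-ᵥ v) i = - (v i)

  0ᵥ : Vec
  0ᵥ i = 0ℝ

  -- equality in ℝ^n / Δ(ℝ): the difference is a multiple of (1,…,1)
  _≈Δ_ : Vec → Vec → Set c
  v ≈Δ w = Σ ℝ λ t → ∀ i → v i ≡ w i + t

  Perm : Set
  Perm = Permutation′ n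

  -- action of a permutation by permuting coordinates: p(v)_{p(i)} = v_i
  act : Perm → Vec → Vec
  act p v i = v (p ⟨$⟩ˡ i)

  -- composition p q = p ∘ q (first q, then p)
  _·ₚ_ : Perm → Perm → Perm
  p ·ₚ q = q ∘ₚ p

  -- elements of G_ℝ = (ℝ^n/Δ(ℝ)) ⋊ Per(n), represented by (v , p) with v ∈ ℝ^n
  G : Set c
  G = Vec × Perm

  _≈G_ : G → G → Set c
  (v , p) ≈G (w , q) = (v ≈Δ w) × (∀ i → p ⟨$⟩ʳ i ≡ q ⟨$⟩ʳ i)

  _·_ : G → G → G
  (v , p) · (w , q) = (v +ᵥ act p w , p ·ₚ q)

  _⁻¹ : G → G
  (v , p) ⁻¹ = (-ᵥ act (flip p) v , flip p)

  conj : G → G → G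
  conj g h = (g · h) · (g ⁻¹)

  Λ : Vec → G
  Λ x = (x , id)

  K : Perm → G
  K q = (0ᵥ , q)

  G⁺ : G → Set c
  G⁺ (v , p) = act p v ≈Δ v

module Submission where

-- Write f = p⁻¹ : Fin n → Fin n, so that p acts on vectors by
-- v ↦ v ∘ f, and ∆u = u - u ∘ f.  Conjugating (v , p) by (x , 1) gives
-- (v + ∆x , p), so the theorem is a statement about the coboundaries ∆x.
-- Since f is a permutation, fᴺ = id for N = n!, and N is invertible in an
-- ordered field.  Three facts about such an f follow by telescoping sums
-- along orbits:
--   * a vector whose ∆ is constant along an orbit has ∆ = 0 there; hence
--     "p(w) = w modulo Δ(ℝ)" already forces p(w) = w exactly, and an
--     f-invariant coboundary ∆z vanishes;
--   * averaging over orbits, x = -(1/N) ∑_{K<N} ∑_{k<K} v ∘ fᵏ satisfies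
--     v + ∆x = (1/N) ∑_{k<N} v ∘ fᵏ, which is f-invariant.
-- The first gives uniqueness of the Λ-representative (two representatives
-- differ by an invariant coboundary), the second its existence, and
-- stability under K-conjugation is a direct computation.

open import Defs
open import Level using (Level; 0ℓ)
open import Data.Nat as ℕ using (ℕ; zero; suc; _≤_; _<_; _!; NonZero)
import Data.Nat.Properties as ℕₚ
open import Data.Nat.Properties using (_!≢0)
open import Data.Nat.Divisibility using (_∣_; ∣-trans; m∣m*n; m≤n⇒m!∣n!; m∣n⇒n≡quotient*m; quotient)
open import Data.Nat.GeneralisedArithmetic using (fold; fold-+; iterate-is-fold)
open import Data.Fin using (Fin; toℕ)
open import Data.Fin.Properties using (pigeonhole; toℕ≤pred[n])
open import Data.Fin.Permutation using (_⟨$⟩ʳ_; _⟨$⟩ˡ_; inverseˡ; inverseʳ)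
open import Data.Product using (Σ; _×_; _,_; proj₁; proj₂)
open import Data.Sum using (inj₁; inj₂)
open import Data.Maybe using (Maybe; just; nothing)
open import Function.Definitions using (Injective)
open import Relation.Nullary using (¬_; yes; no)
open import Relation.Binary.PropositionalEquality using (_≡_)
import Relation.Binary.PropositionalEquality as ≡
open import Algebra.Bundles using (CommutativeRing; RawRing)

-- A ring solver for an arbitrary commutative ring whose constants are
-- integers, represented as formal differences (a , b) ↦ a - b of natural
-- numbers kept in the normal form where one component is zero.
module IntegerCoefficientSolver {c ℓ} (CR : CommutativeRing c ℓ) where
  open CommutativeRing CR
  open import Algebra.Solver.Ring.AlmostCommutativeRing
    using (fromCommutativeRing; _-Raw-AlmostCommutative⟶_)
  open import Algebra.Properties.Semiring.Mult.TCOptimised semiring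
    using (1+×; ×-homo-+; ×1-homo-*) renaming (_×_ to _×ₘ_)
  open import Algebra.Properties.Ring ring using (x[y-z]≈xy-xz; [y-z]x≈yx-zx)
  open import Algebra.Properties.AbelianGroup +-abelianGroup using (⁻¹-anti-homo‿-; ⁻¹-∙-comm)
  open import Algebra.Properties.Group +-group using (ε⁻¹≈ε)
  open import Algebra.Properties.CommutativeSemigroup +-commutativeSemigroup using (interchange)
  open import Relation.Binary.Reasoning.Setoid setoid

  ι : ℕ → Carrier
  ι k = k ×ₘ 1#

  ι-suc : ∀ k → ι (suc k) ≈ 1# + ι k
  ι-suc k = 1+× k 1#

  -- three abelian-group identities: a - b depends only on the integer
  -- represented by (a , b), and this representation respects + and *
  difference-cong : ∀ x y z w → x + w ≈ y + z → x - y ≈ z - w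
  difference-cong x y z w e = begin
    x - y                     ≈⟨ +-identityʳ (x - y) ⟨
    (x - y) + 0#              ≈⟨ +-congˡ (-‿inverseʳ w) ⟨
    (x - y) + (w - w)         ≈⟨ interchange x (- y) w (- w) ⟩
    (x + w) + (- y + - w)     ≈⟨ +-congʳ e ⟩
    (y + z) + (- y + - w)     ≈⟨ interchange y z (- y) (- w) ⟩
    (y - y) + (z - w)         ≈⟨ +-congʳ (-‿inverseʳ y) ⟩
    0# + (z - w)              ≈⟨ +-identityˡ (z - w) ⟩
    z - w                     ∎

  difference-+ : ∀ x y z w → (x + z) - (y + w) ≈ (x - y) + (z - w)
  difference-+ x y z w = begin
    (x + z) - (y + w)         ≈⟨ +-congˡ (⁻¹-∙-comm y w) ⟨
    (x + z) + (- y + - w)     ≈⟨ interchange x z (- y) (- w) ⟩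
    (x - y) + (z - w)         ∎

  difference-* : ∀ x y z w → (x * z + y * w) - (x * w + y * z) ≈ (x - y) * (z - w)
  difference-* x y z w = begin
    (x * z + y * w) - (x * w + y * z)       ≈⟨ difference-+ (x * z) (x * w) (y * w) (y * z) ⟩
    (x * z - x * w) + (y * w - y * z)       ≈⟨ +-congˡ (⁻¹-anti-homo‿- (y * z) (y * w)) ⟨
    (x * z - x * w) - (y * z - y * w)
      ≈⟨ +-cong (x[y-z]≈xy-xz x z w) (-‿cong (x[y-z]≈xy-xz y z w)) ⟨
    x * (z - w) - y * (z - w)               ≈⟨ [y-z]x≈yx-zx (z - w) x y ⟨
    (x - y) * (z - w)                       ∎

  Pair : Set
  Pair = ℕ × ℕ

  reduce : Pair → Pair
  reduce (a , b) = (a ℕ.∸ b , b ℕ.∸ a)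

  -- (a , b) and its reduced form represent the same integer
  ∸-balance : ∀ a b → (a ℕ.∸ b) ℕ.+ b ≡ (b ℕ.∸ a) ℕ.+ a
  ∸-balance zero    zero    = ≡.refl
  ∸-balance zero    (suc b) = ≡.sym (ℕₚ.+-identityʳ (suc b))
  ∸-balance (suc a) zero    = ℕₚ.+-identityʳ (suc a)
  ∸-balance (suc a) (suc b) = ≡.trans (ℕₚ.+-suc (a ℕ.∸ b) b)
    (≡.trans (≡.cong suc (∸-balance a b)) (≡.sym (ℕₚ.+-suc (b ℕ.∸ a) a)))

  infixl 6 _⊕_
  infixl 7 _⊗_

  _⊕_ _⊗_ : Pair → Pair → Pair
  (a , b) ⊕ (c , d) = reduce (a ℕ.+ c , b ℕ.+ d)
  (a , b) ⊗ (c , d) = reduce (a ℕ.* c ℕ.+ b ℕ.* d , a ℕ.* d ℕ.+ b ℕ.* c)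

  ⊖_ : Pair → Pair
  ⊖ (a , b) = (b , a)

  Coefficients : RawRing 0ℓ 0ℓ
  Coefficients = record
    { Carrier = Pair ; _≈_ = _≡_ ; _+_ = _⊕_ ; _*_ = _⊗_ ; -_ = ⊖_
    ; 0# = (0 , 0) ; 1# = (1 , 0) }

  value : Pair → Carrier
  value (a , b) = ι a - ι b

  -- the same element, computing to 0# and 1# on the constants 0 and 1
  embed : Pair → Carrier
  embed (a , zero)  = ι a
  embed (a , suc b) = ι a - ι (suc b)

  embed≈value : ∀ p → embed p ≈ value p
  embed≈value (a , zero)  = sym (trans (+-congˡ ε⁻¹≈ε) (+-identityʳ (ι a)))
  embed≈value (a , suc b) = refl

  value-cong : ∀ a b c d → a ℕ.+ d ≡ b ℕ.+ c → value (a , b) ≈ value (c , d)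
  value-cong a b c d e = difference-cong (ι a) (ι b) (ι c) (ι d) (begin
    ι a + ι d       ≈⟨ ×-homo-+ 1# a d ⟨
    ι (a ℕ.+ d)     ≡⟨ ≡.cong ι e ⟩
    ι (b ℕ.+ c)     ≈⟨ ×-homo-+ 1# b c ⟩
    ι b + ι c       ∎)

  embed-reduce : ∀ a b → embed (reduce (a , b)) ≈ value (a , b)
  embed-reduce a b =
    trans (embed≈value (reduce (a , b))) (value-cong (a ℕ.∸ b) (b ℕ.∸ a) a b (∸-balance a b))

  embed-homomorphism : Coefficients -Raw-AlmostCommutative⟶ fromCommutativeRing CR
  embed-homomorphism = record
    { ⟦_⟧    = embed
    ; +-homo = λ { (a , b) (c , d) → begin
        embed (reduce (a ℕ.+ c , b ℕ.+ d))       ≈⟨ embed-reduce (a ℕ.+ c) (b ℕ.+ d) ⟩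
        ι (a ℕ.+ c) - ι (b ℕ.+ d)                ≈⟨ +-cong (×-homo-+ 1# a c) (-‿cong (×-homo-+ 1# b d)) ⟩
        (ι a + ι c) - (ι b + ι d)                ≈⟨ difference-+ (ι a) (ι b) (ι c) (ι d) ⟩
        value (a , b) + value (c , d)            ≈⟨ +-cong (embed≈value (a , b)) (embed≈value (c , d)) ⟨
        embed (a , b) + embed (c , d)            ∎ }
    ; *-homo = λ { (a , b) (c , d) → begin
        embed (reduce (a ℕ.* c ℕ.+ b ℕ.* d , a ℕ.* d ℕ.+ b ℕ.* c))
          ≈⟨ embed-reduce (a ℕ.* c ℕ.+ b ℕ.* d) (a ℕ.* d ℕ.+ b ℕ.* c) ⟩
        ι (a ℕ.* c ℕ.+ b ℕ.* d) - ι (a ℕ.* d ℕ.+ b ℕ.* c)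
          ≈⟨ +-cong (ι-sum-of-products a c b d) (-‿cong (ι-sum-of-products a d b c)) ⟩
        (ι a * ι c + ι b * ι d) - (ι a * ι d + ι b * ι c)
          ≈⟨ difference-* (ι a) (ι b) (ι c) (ι d) ⟩
        value (a , b) * value (c , d)
          ≈⟨ *-cong (embed≈value (a , b)) (embed≈value (c , d)) ⟨
        embed (a , b) * embed (c , d)            ∎ }
    ; -‿homo = λ { (a , b) → begin
        embed (b , a)        ≈⟨ embed≈value (b , a) ⟩
        ι b - ι a            ≈⟨ ⁻¹-anti-homo‿- (ι a) (ι b) ⟨
        - value (a , b)      ≈⟨ -‿cong (embed≈value (a , b)) ⟨
        - embed (a , b)      ∎ }
    ; 0-homo = refl
    ; 1-homo = refl
    }
    where
    ι-sum-of-products : ∀ a c b d → ι (a ℕ.* c ℕ.+ b ℕ.* d) ≈ ι a * ι c + ι b * ι d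
    ι-sum-of-products a c b d =
      trans (×-homo-+ 1# (a ℕ.* c) (b ℕ.* d)) (+-cong (×1-homo-* a c) (×1-homo-* b d))

  embed-equal? : ∀ p q → Maybe (embed p ≈ embed q)
  embed-equal? (a , b) (c , d) with a ℕ.+ d ℕₚ.≟ b ℕ.+ c
  ... | yes e = just (trans (embed≈value (a , b)) (trans (value-cong a b c d e) (sym (embed≈value (c , d)))))
  ... | no _  = nothing

  open import Algebra.Solver.Ring Coefficients (fromCommutativeRing CR) embed-homomorphism embed-equal? public
    using (Polynomial; con; solve; _:=_; _:+_; _:-_; _:*_; :-_)

  :0 :1 : ∀ {m} → Polynomial m
  :0 = con (0 , 0)
  :1 = con (1 , 0)

module Orbits where
  open ≡.≡-Reasoning

  orbit : {X : Set} → (X → X) → X → ℕ → X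
  orbit f x k = fold x f k

  module _ {X : Set} (f : X → X) where

    -- fᵏ(f x) = fᵏ⁺¹(x); the other form f (fᵏ x) = fᵏ⁺¹(x) holds by definition
    orbit-shift : ∀ x k → orbit f (f x) k ≡ orbit f x (suc k)
    orbit-shift x k = ≡.trans (iterate-is-fold (f x) f k) (≡.sym (iterate-is-fold x f (suc k)))

    orbit-multiple : ∀ {x} m → orbit f x m ≡ x → ∀ q → orbit f x (q ℕ.* m) ≡ x
    orbit-multiple m returns zero = ≡.refl
    orbit-multiple {x} m returns (suc q) = begin
      orbit f x (m ℕ.+ q ℕ.* m)       ≡⟨ fold-+ x f m ⟩
      orbit f (orbit f x (q ℕ.* m)) m ≡⟨ ≡.cong (λ y → orbit f y m) (orbit-multiple m returns q) ⟩
      orbit f x m                     ≡⟨ returns ⟩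
      x                               ∎

    orbit-injective : Injective _≡_ _≡_ f → ∀ k {x y} → orbit f x k ≡ orbit f y k → x ≡ y
    orbit-injective injective zero    same = same
    orbit-injective injective (suc k) same = orbit-injective injective k (injective same)

  module _ {n : ℕ} (f : Fin n → Fin n) (injective : Injective _≡_ _≡_ f) where

    -- by pigeonhole among x, f x, …, fⁿ(x), every point returns within n steps
    return-time : ∀ x → Σ ℕ λ m → 0 < m × m ≤ n × orbit f x m ≡ x
    return-time x with pigeonhole (ℕₚ.n<1+n n) (λ k → orbit f x (toℕ k))
    ... | a , b , a<b , same =
      toℕ b ℕ.∸ toℕ a ,
      ℕₚ.m<n⇒0<n∸m a<b ,
      ℕₚ.≤-trans (ℕₚ.m∸n≤m (toℕ b) (toℕ a)) (toℕ≤pred[n] b) ,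
      orbit-injective f injective (toℕ a) (begin
        orbit f (orbit f x (toℕ b ℕ.∸ toℕ a)) (toℕ a) ≡⟨ fold-+ x f (toℕ a) ⟨
        orbit f x (toℕ a ℕ.+ (toℕ b ℕ.∸ toℕ a))       ≡⟨ ≡.cong (orbit f x) (ℕₚ.m+[n∸m]≡n (ℕₚ.<⇒≤ a<b)) ⟩
        orbit f x (toℕ b)                             ≡⟨ same ⟨
        orbit f x (toℕ a)                             ∎)

    -- hence fⁿ! = id, since every return time m ≤ n divides n!
    period : ∀ x → orbit f x (n !) ≡ x
    period x with return-time x
    ... | suc k , _ , m≤n , returns =
      ≡.subst (λ N → orbit f x N ≡ x) (≡.sym (m∣n⇒n≡quotient*m m∣n!))
        (orbit-multiple f (suc k) returns (quotient m∣n!))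
      where
      m∣n! : suc k ∣ n !
      m∣n! = ∣-trans (m∣m*n {suc k} (k !)) (m≤n⇒m!∣n! m≤n)

module RingFacts {c ℓ} (CR : CommutativeRing c ℓ) where
  open CommutativeRing CR
  open IntegerCoefficientSolver CR using (ι; ι-suc; solve; _:=_; _:+_; _:-_; _:*_; :-_; :0; :1)
  open import Algebra.Properties.Group +-group using (x∙y⁻¹≈ε⇒x≈y)
  open import Relation.Binary.Reasoning.Setoid setoid
  open Orbits

  ∑ : ℕ → (ℕ → Carrier) → Carrier
  ∑ zero    g = 0#
  ∑ (suc K) g = ∑ K g + g K

  syntax ∑ K (λ k → e) = ∑[ k < K ] e

  ∑-cong : ∀ K {g h : ℕ → Carrier} → (∀ k → g k ≈ h k) → ∑ K g ≈ ∑ K h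
  ∑-cong zero    g≈h = refl
  ∑-cong (suc K) g≈h = +-cong (∑-cong K g≈h) (g≈h K)

  ∑-const : ∀ K a → ∑[ k < K ] a ≈ ι K * a
  ∑-const zero    a = sym (zeroˡ a)
  ∑-const (suc K) a = begin
    ∑[ k < K ] a + a    ≈⟨ +-congʳ (∑-const K a) ⟩
    ι K * a + a         ≈⟨ solve 2 (λ i a → i :* a :+ a := (:1 :+ i) :* a) refl (ι K) a ⟩
    (1# + ι K) * a      ≈⟨ *-congʳ (ι-suc K) ⟨
    ι (suc K) * a       ∎

  ∑-difference : ∀ K (g h : ℕ → Carrier) → ∑[ k < K ] (g k - h k) ≈ ∑ K g - ∑ K h
  ∑-difference zero    g h = sym (-‿inverseʳ 0#)
  ∑-difference (suc K) g h = begin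
    ∑[ k < K ] (g k - h k) + (g K - h K) ≈⟨ +-congʳ (∑-difference K g h) ⟩
    (∑ K g - ∑ K h) + (g K - h K)        ≈⟨ solve 4 (λ G H a b → (G :- H) :+ (a :- b) := (G :+ a) :- (H :+ b))
                                                refl (∑ K g) (∑ K h) (g K) (h K) ⟩
    (∑ K g + g K) - (∑ K h + h K)        ∎

  ∑-telescope : ∀ K (g : ℕ → Carrier) → ∑[ k < K ] (g k - g (suc k)) ≈ g 0 - g K
  ∑-telescope zero    g = sym (-‿inverseʳ (g 0))
  ∑-telescope (suc K) g = begin
    ∑[ k < K ] (g k - g (suc k)) + (g K - g (suc K)) ≈⟨ +-congʳ (∑-telescope K g) ⟩
    (g 0 - g K) + (g K - g (suc K))                  ≈⟨ solve 3 (λ a b c → (a :- b) :+ (b :- c) := a :- c)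
                                                           refl (g 0) (g K) (g (suc K)) ⟩
    g 0 - g (suc K)                                  ∎

  module Periodic {X : Set} (f : X → X) (N : ℕ) (periodic : ∀ x → orbit f x N ≡ x)
                  (N⁻¹ : Carrier) (N*N⁻¹≈1 : ι N * N⁻¹ ≈ 1#) where

    Δ : (X → Carrier) → X → Carrier
    Δ u x = u x - u (f x)

    Invariant : (X → Carrier) → Set ℓ
    Invariant u = ∀ x → u (f x) ≈ u x

    Δ-partial-orbit-sum : ∀ K u x →
      Δ (λ y → ∑[ k < K ] u (orbit f y k)) x ≈ u x - u (orbit f x K)
    Δ-partial-orbit-sum K u x = begin
      ∑[ k < K ] u (orbit f x k) - ∑[ k < K ] u (orbit f (f x) k)
        ≈⟨ ∑-difference K (λ k → u (orbit f x k)) (λ k → u (orbit f (f x) k)) ⟨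
      ∑[ k < K ] (u (orbit f x k) - u (orbit f (f x) k))
        ≈⟨ ∑-cong K (λ k → +-congˡ (-‿cong (reflexive (≡.cong u (orbit-shift f x k))))) ⟩
      ∑[ k < K ] (u (orbit f x k) - u (orbit f x (suc k)))
        ≈⟨ ∑-telescope K (λ k → u (orbit f x k)) ⟩
      u x - u (orbit f x K) ∎

    Δ-orbit-sum : ∀ u x → ∑[ k < N ] Δ u (orbit f x k) ≈ 0#
    Δ-orbit-sum u x = begin
      ∑[ k < N ] Δ u (orbit f x k) ≈⟨ ∑-telescope N (λ k → u (orbit f x k)) ⟩
      u x - u (orbit f x N)        ≈⟨ +-congˡ (-‿cong (reflexive (≡.cong u (periodic x)))) ⟩
      u x - u x                    ≈⟨ -‿inverseʳ (u x) ⟩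
      0#                           ∎

    N*-cancel : ∀ a → ι N * a ≈ 0# → a ≈ 0#
    N*-cancel a Na≈0 = begin
      a                   ≈⟨ *-identityˡ a ⟨
      1# * a              ≈⟨ *-congʳ N*N⁻¹≈1 ⟨
      (ι N * N⁻¹) * a     ≈⟨ solve 3 (λ m m⁻¹ a → (m :* m⁻¹) :* a := m⁻¹ :* (m :* a)) refl (ι N) N⁻¹ a ⟩
      N⁻¹ * (ι N * a)     ≈⟨ *-congˡ Na≈0 ⟩
      N⁻¹ * 0#            ≈⟨ zeroʳ N⁻¹ ⟩
      0#                  ∎

    constant-Δ-vanishes : ∀ u x a → (∀ k → Δ u (orbit f x k) ≈ a) → a ≈ 0#
    constant-Δ-vanishes u x a constant = N*-cancel a (begin
      ι N * a                      ≈⟨ ∑-const N a ⟨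
      ∑[ k < N ] a                 ≈⟨ ∑-cong N constant ⟨
      ∑[ k < N ] Δ u (orbit f x k) ≈⟨ Δ-orbit-sum u x ⟩
      0#                           ∎)

    drift-invariant : ∀ u s → (∀ x → u (f x) ≈ u x + s) → Invariant u
    drift-invariant u s drift x = begin
      u (f x)    ≈⟨ drift x ⟩
      u x + s    ≈⟨ +-congˡ s≈0 ⟩
      u x + 0#   ≈⟨ +-identityʳ (u x) ⟩
      u x        ∎
      where
      Δu≈-s : ∀ y → Δ u y ≈ - s
      Δu≈-s y = begin
        u y - u (f y)  ≈⟨ +-congˡ (-‿cong (drift y)) ⟩
        u y - (u y + s) ≈⟨ solve 2 (λ a s → a :- (a :+ s) := :- s) refl (u y) s ⟩
        - s            ∎
      s≈0 : s ≈ 0#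
      s≈0 = begin
        s       ≈⟨ solve 1 (λ s → s := :- (:- s)) refl s ⟩
        - (- s) ≈⟨ -‿cong (constant-Δ-vanishes u x (- s) (λ k → Δu≈-s (orbit f x k))) ⟩
        - 0#    ≈⟨ solve 0 (:- :0 := :0) refl ⟩
        0#      ∎

    invariant-on-orbit : ∀ u → Invariant u → ∀ x k → u (orbit f x k) ≈ u x
    invariant-on-orbit u invariant x zero    = refl
    invariant-on-orbit u invariant x (suc k) = trans (invariant (orbit f x k)) (invariant-on-orbit u invariant x k)

    invariant-Δ-vanishes : ∀ z → Invariant (Δ z) → ∀ x → Δ z x ≈ 0#
    invariant-Δ-vanishes z invariant x =
      constant-Δ-vanishes z x (Δ z x) (invariant-on-orbit (Δ z) invariant x)

    orbit-sum : (X → Carrier) → X → Carrier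
    orbit-sum v x = ∑[ k < N ] v (orbit f x k)

    orbit-sum-invariant : ∀ v → Invariant (orbit-sum v)
    orbit-sum-invariant v x = sym (x∙y⁻¹≈ε⇒x≈y (orbit-sum v x) (orbit-sum v (f x)) (begin
      Δ (orbit-sum v) x     ≈⟨ Δ-partial-orbit-sum N v x ⟩
      v x - v (orbit f x N) ≈⟨ +-congˡ (-‿cong (reflexive (≡.cong v (periodic x)))) ⟩
      v x - v x             ≈⟨ -‿inverseʳ (v x) ⟩
      0#                    ∎))

    -- the vector part x + v - x ∘ f of (x , 1) (v , p) (x , 1)⁻¹
    twist : (X → Carrier) → (X → Carrier) → X → Carrier
    twist x v y = (x y + v y) - x (f y)

    potential : (X → Carrier) → X → Carrier
    potential v x = ∑[ K < N ] ∑[ k < K ] v (orbit f x k)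

    Δ-potential : ∀ v x → Δ (potential v) x ≈ ι N * v x - orbit-sum v x
    Δ-potential v x = begin
      Δ (potential v) x
        ≈⟨ ∑-difference N (λ K → ∑[ k < K ] v (orbit f x k)) (λ K → ∑[ k < K ] v (orbit f (f x) k)) ⟨
      ∑[ K < N ] Δ (λ y → ∑[ k < K ] v (orbit f y k)) x
        ≈⟨ ∑-cong N (λ K → Δ-partial-orbit-sum K v x) ⟩
      ∑[ K < N ] (v x - v (orbit f x K))
        ≈⟨ ∑-difference N (λ _ → v x) (λ K → v (orbit f x K)) ⟩
      ∑[ K < N ] v x - orbit-sum v x
        ≈⟨ +-congʳ (∑-const N (v x)) ⟩
      ι N * v x - orbit-sum v x ∎

    averager : (X → Carrier) → X → Carrier
    averager v x = - (N⁻¹ * potential v x)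

    averaging-twist : ∀ v y → twist (averager v) v y ≈ N⁻¹ * orbit-sum v y
    averaging-twist v y = begin
      (- (N⁻¹ * P y) + v y) - - (N⁻¹ * P (f y))
        ≈⟨ solve 4 (λ m⁻¹ a b w → (:- (m⁻¹ :* a) :+ w) :- :- (m⁻¹ :* b) := w :- m⁻¹ :* (a :- b))
             refl N⁻¹ (P y) (P (f y)) (v y) ⟩
      v y - N⁻¹ * Δ P y
        ≈⟨ +-congˡ (-‿cong (*-congˡ (Δ-potential v y))) ⟩
      v y - N⁻¹ * (ι N * v y - orbit-sum v y)
        ≈⟨ solve 4 (λ m m⁻¹ w o → w :- m⁻¹ :* (m :* w :- o) := m⁻¹ :* o :+ (:1 :- m :* m⁻¹) :* w)
             refl (ι N) N⁻¹ (v y) (orbit-sum v y) ⟩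
      N⁻¹ * orbit-sum v y + (1# - ι N * N⁻¹) * v y
        ≈⟨ +-congˡ (*-congʳ (+-congˡ (-‿cong N*N⁻¹≈1))) ⟩
      N⁻¹ * orbit-sum v y + (1# - 1#) * v y
        ≈⟨ solve 3 (λ m⁻¹ o w → m⁻¹ :* o :+ (:1 :- :1) :* w := m⁻¹ :* o) refl N⁻¹ (orbit-sum v y) (v y) ⟩
      N⁻¹ * orbit-sum v y ∎
      where P = potential v

    averager-invariant : ∀ v → Invariant (twist (averager v) v)
    averager-invariant v y = begin
      twist (averager v) v (f y)         ≈⟨ averaging-twist v (f y) ⟩
      N⁻¹ * orbit-sum v (f y)  ≈⟨ *-congˡ (orbit-sum-invariant v y) ⟩
      N⁻¹ * orbit-sum v y      ≈⟨ averaging-twist v y ⟨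
      twist (averager v) v y   ∎

    -- two invariant twists of v differ by an invariant coboundary, hence agree
    invariant-twist-unique : ∀ v x x′ → Invariant (twist x v) → Invariant (twist x′ v) →
                             ∀ y → twist x v y ≈ twist x′ v y
    invariant-twist-unique v x x′ invariant invariant′ y =
      x∙y⁻¹≈ε⇒x≈y (twist x v y) (twist x′ v y)
        (trans (twist-difference y) (invariant-Δ-vanishes z Δz-invariant y))
      where
      z : X → Carrier
      z y = x y - x′ y
      twist-difference : ∀ y → twist x v y - twist x′ v y ≈ Δ z y
      twist-difference y = solve 5 (λ a a′ b b′ w → ((a :+ w) :- b) :- ((a′ :+ w) :- b′) := (a :- a′) :- (b :- b′))
                             refl (x y) (x′ y) (x (f y)) (x′ (f y)) (v y)
      Δz-invariant : Invariant (Δ z)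
      Δz-invariant y = begin
        Δ z (f y)                             ≈⟨ twist-difference (f y) ⟨
        twist x v (f y) - twist x′ v (f y)    ≈⟨ +-cong (invariant y) (-‿cong (invariant′ y)) ⟩
        twist x v y - twist x′ v y            ≈⟨ twist-difference y ⟩
        Δ z y                                 ∎

module OrderedField {c} (R : RealField c) where
  open RealField R renaming (_≤_ to _≤ℝ_)
  open import Relation.Binary.PropositionalEquality using (subst; subst₂)

  commutativeRing : CommutativeRing c c
  commutativeRing = record { isCommutativeRing = isCommutativeRing }

  open IntegerCoefficientSolver commutativeRing using (ι; ι-suc; solve; _:=_; _:+_; _:-_; _:*_; :-_; :0; :1)

  0≤1 : 0ℝ ≤ℝ 1ℝ
  0≤1 with ≤-total 0ℝ 1ℝ
  ... | inj₁ 0≤1 = 0≤1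
  ... | inj₂ 1≤0 = subst (0ℝ ≤ℝ_) (solve 0 (:- :1 :* :- :1 := :1) ≡.refl) (*-nonneg 0≤-1 0≤-1)
    where
    0≤-1 : 0ℝ ≤ℝ - 1ℝ
    0≤-1 = subst₂ _≤ℝ_ (solve 0 (:1 :- :1 := :0) ≡.refl) (solve 0 (:0 :- :1 := :- :1) ≡.refl)
             (+-mono-≤ (- 1ℝ) 1≤0)

  -- 0 + 1 ≤ℝ a + 1 whenever 0 ≤ℝ a, and a + 1 = ι (suc k) for a = ι k
  1≤ι-suc : ∀ k → 0ℝ ≤ℝ ι k → 1ℝ ≤ℝ ι (suc k)
  1≤ι-suc k 0≤k = subst₂ _≤ℝ_ (solve 0 (:0 :+ :1 := :1) ≡.refl)
                    (≡.trans (solve 1 (λ a → a :+ :1 := :1 :+ a) ≡.refl (ι k)) (≡.sym (ι-suc k)))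
                    (+-mono-≤ 1ℝ 0≤k)

  0≤ι : ∀ k → 0ℝ ≤ℝ ι k
  0≤ι zero    = ≤-refl 0ℝ
  0≤ι (suc k) = ≤-trans 0≤1 (1≤ι-suc k (0≤ι k))

  ι-nonzero : ∀ N → .{{NonZero N}} → ¬ (ι N ≡ 0ℝ)
  ι-nonzero (suc k) ιN≡0 = 0≢1 (≤-antisym 0≤1 (subst (1ℝ ≤ℝ_) ιN≡0 (1≤ι-suc k (0≤ι k))))

  _⁻¹ℕ : ∀ N → .{{NonZero N}} → Σ ℝ λ N⁻¹ → ι N * N⁻¹ ≡ 1ℝ
  N ⁻¹ℕ = inverse (ι N) (ι-nonzero N)

module Conjugacy {c} (R : RealField c) (n : ℕ) where
  open Semidirect R n
  open RealField R using (_+_; -_; 0ℝ)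
  open OrderedField R using (commutativeRing; _⁻¹ℕ)
  open RingFacts commutativeRing
  open CommutativeRing commutativeRing using (+-identityʳ)
  open IntegerCoefficientSolver commutativeRing using (solve; _:=_; _:+_; _:-_; :0)

  -- for (v , p) the relevant map is f = p⁻¹, acting on vectors by v ↦ v ∘ f
  module ForPermutation (p : Perm) where
    f : Fin n → Fin n
    f = p ⟨$⟩ˡ_

    f-injective : Injective _≡_ _≡_ f
    f-injective fi≡fj =
      ≡.trans (≡.sym (inverseʳ p)) (≡.trans (≡.cong (p ⟨$⟩ʳ_) fi≡fj) (inverseʳ p))

    instance _ = n !≢0

    open Periodic f (n !) (Orbits.period f f-injective)
                  (proj₁ ((n !) ⁻¹ℕ)) (proj₂ ((n !) ⁻¹ℕ)) public

  Λ-representative : (g : G) → Σ Vec λ x → G⁺ (conj (Λ x) g)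
  Λ-representative (v , p) =
    averager v , 0ℝ , λ i → ≡.trans (averager-invariant v i) (≡.sym (+-identityʳ _))
    where open ForPermutation p

  Λ-representative-unique : (g : G) (x y : Vec) → G⁺ (conj (Λ x) g) → G⁺ (conj (Λ y) g) →
                            conj (Λ x) g ≈G conj (Λ y) g
  Λ-representative-unique (v , p) x y (s , drift) (s′ , drift′) =
    (0ℝ , λ i → ≡.trans (invariant-twist-unique v x y invariant invariant′ i) (≡.sym (+-identityʳ _))) ,
    λ i → ≡.refl
    where
    open ForPermutation p
    invariant : Invariant (twist x v)
    invariant = drift-invariant (twist x v) s drift
    invariant′ : Invariant (twist y v)
    invariant′ = drift-invariant (twist y v) s′ drift′

  -- conjugation by (0 , q) sends (v , p) to (q v , q p q⁻¹), and (q p q⁻¹)(q v) = q (p v)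
  K-conjugation-preserves-G⁺ : (q : Perm) (h : G) → G⁺ h → G⁺ (conj (K q) h)
  K-conjugation-preserves-G⁺ q (v , p) (t , drift) = t , λ i → begin
    (0ℝ + v (q ⟨$⟩ˡ (q ⟨$⟩ʳ (p ⟨$⟩ˡ (q ⟨$⟩ˡ i))))) + - 0ℝ
      ≡⟨ ≡.cong (λ j → (0ℝ + v j) + - 0ℝ) (inverseˡ q) ⟩
    (0ℝ + v (p ⟨$⟩ˡ (q ⟨$⟩ˡ i))) + - 0ℝ
      ≡⟨ ≡.cong (λ a → (0ℝ + a) + - 0ℝ) (drift (q ⟨$⟩ˡ i)) ⟩
    (0ℝ + (v (q ⟨$⟩ˡ i) + t)) + - 0ℝ
      ≡⟨ solve 2 (λ a t → (:0 :+ (a :+ t)) :- :0 := ((:0 :+ a) :- :0) :+ t) ≡.refl (v (q ⟨$⟩ˡ i)) t ⟩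
    ((0ℝ + v (q ⟨$⟩ˡ i)) + - 0ℝ) + t ∎
    where open ≡.≡-Reasoning

mainTheorem1 : {c : Level} (R : RealField c) (n : ℕ) → 2 ≤ n →
    let open Semidirect R n in
      ((g : G) → Σ Vec λ x → G⁺ (conj (Λ x) g))
      × ((g : G) (x y : Vec) → G⁺ (conj (Λ x) g) → G⁺ (conj (Λ y) g) →
          conj (Λ x) g ≈G conj (Λ y) g)
      × ((q : Perm) (h : G) → G⁺ h → G⁺ (conj (K q) h))
mainTheorem1 R n _ = Λ-representative , Λ-representative-unique , K-conjugation-preserves-G⁺
  where open Conjugacy R n
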